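{- Let $d$ be a positive integer and $\mathcal D$ a nonempty Ferrers diagram of order $n$. Then $(\mathcal D,d)$ is irreducible if and only if $\mathcal D$ is a source (a vertex with no incoming edges) of the digraph $\mathfrak G_{d,n}/\mathcal T_d$.
   Context: A Ferrers diagram is a finite $\mathcal D\subseteq\mathbb N^2$ ($\mathbb N=\{1,2,\dots\}$) with $(x,y)\in\mathcal D\Rightarrow(i,j)\in\mathcal D$ for all $1\le i\le x$, $1\le j\le y$; order $n$ means $\mathcal D\subseteq\{1,\dots,n\}^2$. $\mathcal T_d=\{(i,j)\in\mathbb N^2:i+j\le d+1\}$. $\nu_j(\mathcal D,d)=|\{(x,y)\in\mathcal D:x\ge d-j,\ y\ge j+1\}|$ for $0\le j\le d-1$, $\nu_{\min}(\mathcal D,d)=\min_j\nu_j(\mathcal D,d)$. For $P\in\mathcal D$ such that $\mathcal D'=\mathcal D\setminus\{P\}$ is a Ferrers diagram: if $\nu_{\min}(\mathcal D',d)=\nu_{\min}(\mathcal D,d)$ write $\mathcal D'\xrightarrow{d}\mathcal D$, otherwise $\mathcal D\xrightarrow{d}\mathcal D'$. $(\mathcal D,d)$ is irreducible if there is no Ferrers diagram $\mathcal D'$ with $\mathcal D'\xrightarrow{d}\mathcal D$. $\mathfrak G_{d,n}$ is the digraph on the Ferrers diagrams of order $n$ with an edge $(\mathcal D,\mathcal D')$ iff $\mathcal D\xrightarrow{d}\mathcal D'$; $\mathfrak G_{d,n}/\mathcal T_d$ is its induced subdigraph on the Ferrers diagrams of order $n$ containing $\mathcal T_d$. -}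

module Defs where

open import Data.Bool using (Bool; true; false; _∧_; if_then_else_)
open import Data.Nat using (ℕ; zero; suc; _+_; _∸_; _≤_; _⊓_; _≤ᵇ_; _≡ᵇ_)
open import Data.List using (List; map; foldr; upTo)
open import Data.Nat.ListAction using (sum)
open import Data.Product using (Σ; _×_; _,_)
open import Data.Sum using (_⊎_)
open import Relation.Binary.PropositionalEquality using (_≡_; _≢_)
open import Relation.Nullary using (¬_)

-- Points are pairs (x , y); the paper's ℕ = {1,2,...}, so points with a
-- zero coordinate are excluded by IsFerrers below.
Diagram : Set
Diagram = ℕ → ℕ → Bool

Point : Set
Point = ℕ × ℕ

IsFerrers : ℕ → Diagram → Set
IsFerrers n D =
  (∀ y → D 0 y ≡ false) ×
  (∀ x → D x 0 ≡ false) ×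
  (∀ x y → D x y ≡ true → (x ≤ n × y ≤ n)) ×
  (∀ x y i j → D x y ≡ true → 1 ≤ i → i ≤ x → 1 ≤ j → j ≤ y → D i j ≡ true)

Nonempty : Diagram → Set
Nonempty D = Σ ℕ λ x → Σ ℕ λ y → D x y ≡ true

ContainsT : ℕ → Diagram → Set
ContainsT d D = ∀ i j → 1 ≤ i → 1 ≤ j → i + j ≤ d + 1 → D i j ≡ true

Minus : Diagram → Point → Diagram
Minus D (a , b) x y = if (x ≡ᵇ a) ∧ (y ≡ᵇ b) then false else D x y

IsRemoval : Diagram → Diagram → Point → Set
IsRemoval D' D (a , b) = (D a b ≡ true) × (∀ x y → D' x y ≡ Minus D (a , b) x y)

sum1 : ℕ → (ℕ → ℕ) → ℕ
sum1 n f = sum (map (λ k → f (suc k)) (upTo n))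

indic : Bool → ℕ
indic true  = 1
indic false = 0

-- ν_j(D,d) = |{(x,y) ∈ D : x ≥ d - j, y ≥ j + 1}|, for D of order n
-- (so it suffices to count over {1..n}²).
ν : ℕ → ℕ → Diagram → ℕ → ℕ
ν n d D j = sum1 n λ x → sum1 n λ y →
  indic (D x y ∧ ((d ∸ j) ≤ᵇ x) ∧ ((j + 1) ≤ᵇ y))

-- ν_min(D,d) = min_{0 ≤ j ≤ d-1} ν_j(D,d)   (meaningful for d ≥ 1)
νmin : ℕ → ℕ → Diagram → ℕ
νmin n d D = foldr _⊓_ (ν n d D 0) (map (ν n d D) (upTo d))

Arrow : ℕ → ℕ → Diagram → Diagram → Set
Arrow n d A B =
  (Σ Point λ P → IsRemoval A B P × νmin n d A ≡ νmin n d B) ⊎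
  (Σ Point λ P → IsRemoval B A P × νmin n d B ≢ νmin n d A)

Irreducible : ℕ → ℕ → Diagram → Set
Irreducible n d D = ¬ (Σ Diagram λ D' → IsFerrers n D' × Arrow n d D' D)

-- D is a source of 𝔊_{d,n}/T_d: D is a vertex (contains T_d) and no vertex
-- D' of 𝔊_{d,n}/T_d has an edge (D', D).
IsSourceGT : ℕ → ℕ → Diagram → Set
IsSourceGT n d D = ContainsT d D ×
  ¬ (Σ Diagram λ D' → IsFerrers n D' × ContainsT d D' × Arrow n d D' D)

-- A source of 𝔊_{d,n}/T_d is irreducible: an arrow D' →_d D has either
-- D' = D ∪ {P}, so D' ⊇ D ⊇ T_d, or D' = D ∖ {P} with ν_min(D') = ν_min(D) ≥ 1
-- (each quadrant of ν_j contains the point (d − j, j + 1) of T_d); but a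
-- down-closed diagram missing a point (i, j) of T_d has ν_{j−1} = 0, so again
-- D' ⊇ T_d. Conversely, if D misses a point of T_d then ν_min(D) = 0, and
-- deleting a corner P of D leaves a Ferrers diagram with ν_min still 0; this
-- gives an arrow D ∖ {P} →_d D, so an irreducible D contains T_d, and is then
-- trivially a source.
module Submission where

open import Defs
open import Data.Nat using (ℕ; _≤_)
open import Function.Bundles using (_⇔_)

open import Data.Bool using (true; false; _∧_)
open import Data.Bool.Properties using (T-≡)
open import Data.Empty using (⊥-elim)
open import Data.List using (_∷_; foldr)
open import Data.List.Membership.Propositional using (_∈_)
open import Data.List.Membership.Propositional.Properties using (∈-map⁺; ∈-upTo⁺)
open import Data.List.Relation.Unary.All as All using (All; []; _∷_)
open import Data.List.Relation.Unary.All.Properties using (map⁺; applyUpTo⁺₂; all-upTo)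
open import Data.List.Relation.Unary.Any using (here; there)
open import Data.Nat using (zero; suc; _+_; _∸_; _<_; _⊓_; _≤ᵇ_; _≡ᵇ_; _≟_; z≤n; s≤s; s≤s⁻¹)
open import Data.Nat.ListAction using (sum)
open import Data.Nat.Properties
open import Data.Product using (Σ; _×_; _,_)
open import Data.Sum using (inj₁; inj₂)
open import Function using (id)
open import Function.Bundles using (mk⇔; Equivalence)
open import Relation.Nullary using (¬_; yes; no; ofʸ; _×-dec_)
open import Relation.Binary.PropositionalEquality

∈⇒≤sum : ∀ {m ms} → m ∈ ms → m ≤ sum ms
∈⇒≤sum {m} {ms = _ ∷ ms} (here refl)  = m≤m+n m (sum ms)
∈⇒≤sum {ms = k ∷ _}      (there m∈ms) = m≤n⇒m≤o+n k (∈⇒≤sum m∈ms)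

sum≡0 : ∀ {ms} → All (_≡ 0) ms → sum ms ≡ 0
sum≡0 []             = refl
sum≡0 (refl ∷ ms≡0) = sum≡0 ms≡0

foldr-⊓-≤ : ∀ z {m ms} → m ∈ ms → foldr _⊓_ z ms ≤ m
foldr-⊓-≤ z {ms = m ∷ ms} (here refl)  = m⊓n≤m m (foldr _⊓_ z ms)
foldr-⊓-≤ z {ms = k ∷ ms} (there m∈ms) = ≤-trans (m⊓n≤n k _) (foldr-⊓-≤ z m∈ms)

≤-foldr-⊓ : ∀ {m z ms} → m ≤ z → All (m ≤_) ms → m ≤ foldr _⊓_ z ms
≤-foldr-⊓ m≤z []             = m≤z
≤-foldr-⊓ m≤z (m≤k ∷ m≤ms) = ⊓-glb m≤k (≤-foldr-⊓ m≤z m≤ms)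

≤sum1 : ∀ n f {x} → 1 ≤ x → x ≤ n → f x ≤ sum1 n f
≤sum1 n f {suc k} _ k<n = ∈⇒≤sum (∈-map⁺ (λ k → f (suc k)) (∈-upTo⁺ k<n))

sum1≡0 : ∀ n f → (∀ x → f x ≡ 0) → sum1 n f ≡ 0
sum1≡0 n f f≡0 = sum≡0 (map⁺ (applyUpTo⁺₂ id n (λ k → f≡0 (suc k))))

indic-∧-≤ᵇ≡0 : ∀ b a x c y → (a ≤ x → c ≤ y → b ≡ false) → indic (b ∧ (a ≤ᵇ x) ∧ (c ≤ᵇ y)) ≡ 0
indic-∧-≤ᵇ≡0 false a x c y _ = refl
indic-∧-≤ᵇ≡0 true  a x c y h with a ≤ᵇ x | ≤ᵇ-reflects-≤ a x | c ≤ᵇ y | ≤ᵇ-reflects-≤ c y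
... | false | _        | _     | _        = refl
... | true  | _        | false | _        = refl
... | true  | ofʸ a≤x | true  | ofʸ c≤y with () ← h a≤x c≤y

indic-∧-≤ᵇ≡1 : ∀ {b a x c y} → b ≡ true → a ≤ x → c ≤ y → indic (b ∧ (a ≤ᵇ x) ∧ (c ≤ᵇ y)) ≡ 1
indic-∧-≤ᵇ≡1 {a = a} {x} {c} {y} refl a≤x c≤y with a ≤ᵇ x | ≤⇒≤ᵇ a≤x | c ≤ᵇ y | ≤⇒≤ᵇ c≤y
... | true | _ | true | _ = refl

ν≡0 : ∀ n d D j → (∀ x y → d ∸ j ≤ x → j + 1 ≤ y → D x y ≡ false) → ν n d D j ≡ 0
ν≡0 n d D j outside =
  sum1≡0 n _ λ x → sum1≡0 n _ λ y → indic-∧-≤ᵇ≡0 (D x y) _ x _ y (outside x y)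

1≤ν : ∀ n d D j {x y} → D x y ≡ true → 1 ≤ x → x ≤ n → 1 ≤ y → y ≤ n →
      d ∸ j ≤ x → j + 1 ≤ y → 1 ≤ ν n d D j
1≤ν n d D j {x} {y} Dxy 1≤x x≤n 1≤y y≤n d∸j≤x j+1≤y = begin
  1                   ≡⟨ sym (indic-∧-≤ᵇ≡1 Dxy d∸j≤x j+1≤y) ⟩
  summand x y         ≤⟨ ≤sum1 n (summand x) 1≤y y≤n ⟩
  sum1 n (summand x)  ≤⟨ ≤sum1 n (λ x → sum1 n (summand x)) 1≤x x≤n ⟩
  ν n d D j           ∎
  where
  open ≤-Reasoning
  summand : ℕ → ℕ → ℕ
  summand x y = indic (D x y ∧ ((d ∸ j) ≤ᵇ x) ∧ ((j + 1) ≤ᵇ y))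

νmin≤ν : ∀ n d D {j} → j < d → νmin n d D ≤ ν n d D j
νmin≤ν n d D j<d = foldr-⊓-≤ (ν n d D 0) (∈-map⁺ (ν n d D) (∈-upTo⁺ j<d))

≤νmin : ∀ n d D {m} → 1 ≤ d → (∀ j → j < d → m ≤ ν n d D j) → m ≤ νmin n d D
≤νmin n d D 1≤d m≤ν = ≤-foldr-⊓ (m≤ν 0 1≤d) (map⁺ (All.map (m≤ν _) (all-upTo d)))

DownClosed : Diagram → Set
DownClosed D = ∀ x y i j → D x y ≡ true → 1 ≤ i → i ≤ x → 1 ≤ j → j ≤ y → D i j ≡ true

isFerrers⇒downClosed : ∀ {n D} → IsFerrers n D → DownClosed D
isFerrers⇒downClosed (_ , _ , _ , D↓) = D↓

-- Missing (i, j) empties the quadrant of ν_{j-1}, which lies above and to the right of (i, j).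
νmin≡0-if-misses-T : ∀ n d D → DownClosed D → ∀ {i j} → 1 ≤ i → 1 ≤ j → i + j ≤ d + 1 →
                     D i j ≡ false → νmin n d D ≡ 0
νmin≡0-if-misses-T n d D D↓ {i} {suc j} 1≤i _ i+j<d+1 Dij≡false =
  n≤0⇒n≡0 (≤-trans (νmin≤ν n d D j<d) (≤-reflexive (ν≡0 n d D j outside)))
  where
  i+j≤d : i + j ≤ d
  i+j≤d = s≤s⁻¹ (subst₂ _≤_ (+-suc i j) (+-comm d 1) i+j<d+1)
  j<d : j < d
  j<d = ≤-trans (+-monoˡ-≤ j 1≤i) i+j≤d
  outside : ∀ x y → d ∸ j ≤ x → j + 1 ≤ y → D x y ≡ false
  outside x y d∸j≤x j+1≤y with D x y in Dxy
  ... | false = refl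
  ... | true with () ← trans (sym Dij≡false)
        (D↓ x y i (suc j) Dxy 1≤i (≤-trans (m+n≤o⇒m≤o∸n i i+j≤d) d∸j≤x) (s≤s z≤n)
            (subst (_≤ y) (+-comm j 1) j+1≤y))

1≤νmin : ∀ n d D → 1 ≤ d → IsFerrers n D → ContainsT d D → 1 ≤ νmin n d D
1≤νmin n d D 1≤d (_ , _ , bounded , _) T⊆D = ≤νmin n d D 1≤d λ j j<d →
  let Dxy = T⊆D (d ∸ j) (j + 1) (m<n⇒0<n∸m j<d) (m≤n+m 1 j) (≤-reflexive (sum≡d+1 j<d))
      (x≤n , y≤n) = bounded _ _ Dxy
  in 1≤ν n d D j Dxy (m<n⇒0<n∸m j<d) x≤n (m≤n+m 1 j) y≤n ≤-refl ≤-refl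
  where
  sum≡d+1 : ∀ {j} → j < d → d ∸ j + (j + 1) ≡ d + 1
  sum≡d+1 {j} j<d = trans (sym (+-assoc (d ∸ j) j 1)) (cong (_+ 1) (m∸n+n≡m (<⇒≤ j<d)))

Minus-⊆ : ∀ D P {x y} → Minus D P x y ≡ true → D x y ≡ true
Minus-⊆ D (a , b) {x} {y} M with (x ≡ᵇ a) ∧ (y ≡ᵇ b) | M
... | false | Dxy = Dxy

Minus-false : ∀ D P {x y} → D x y ≡ false → Minus D P x y ≡ false
Minus-false D (a , b) {x} {y} Dxy with (x ≡ᵇ a) ∧ (y ≡ᵇ b)
... | true  = refl
... | false = Dxy

≡ᵇ-refl : ∀ m → (m ≡ᵇ m) ≡ true
≡ᵇ-refl m = Equivalence.to T-≡ (≡⇒≡ᵇ m m refl)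

Minus-removes : ∀ D a b → Minus D (a , b) a b ≡ false
Minus-removes D a b rewrite ≡ᵇ-refl a | ≡ᵇ-refl b = refl

Minus-keeps : ∀ D {a b x y} → ¬ (x ≡ a × y ≡ b) → Minus D (a , b) x y ≡ D x y
Minus-keeps D {a} {b} {x} {y} ne with x ≡ᵇ a in x≡ᵇa | y ≡ᵇ b in y≡ᵇb
... | false | _     = refl
... | true  | false = refl
... | true  | true  =
  ⊥-elim (ne (≡ᵇ⇒≡ x a (Equivalence.from T-≡ x≡ᵇa) , ≡ᵇ⇒≡ y b (Equivalence.from T-≡ y≡ᵇb)))

Corner : Diagram → Point → Set
Corner D (a , b) = D a b ≡ true × D (suc a) b ≡ false × D a (suc b) ≡ false

corner-exists : ∀ {n D} → IsFerrers n D → Nonempty D → Σ Point (Corner D)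
corner-exists {n} {D} (_ , _ , bounded , _) (x₀ , y₀ , Dx₀y₀) =
  climb (n + n) x₀ y₀ Dx₀y₀ (m≤m+n (n + n) (x₀ + y₀))
  where
  sum≤n+n : ∀ {x y} → D x y ≡ true → x + y ≤ n + n
  sum≤n+n Dxy = let (x≤n , y≤n) = bounded _ _ Dxy in +-mono-≤ x≤n y≤n

  -- Each step raises x + y, which never exceeds n + n, so n + n steps of fuel suffice.
  climb : ∀ k x y → D x y ≡ true → n + n ≤ k + (x + y) → Σ Point (Corner D)
  step  : ∀ k {x y x' y'} → D x' y' ≡ true → x' + y' ≡ suc (x + y) → n + n ≤ k + (x + y) →
          Σ Point (Corner D)

  climb k x y Dxy fuel with D (suc x) y in right | D x (suc y) in up
  ... | false | false = (x , y) , Dxy , right , up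
  ... | true  | _     = step k {x} {y} right refl fuel
  ... | false | true  = step k {x} {y} up (+-suc x y) fuel

  step zero {x} {y} Dx'y' x'+y'≡ fuel =
    ⊥-elim (n≮n (x + y) (≤-trans (≤-reflexive (sym x'+y'≡)) (≤-trans (sum≤n+n Dx'y') fuel)))
  step (suc k) {x} {y} {x'} {y'} Dx'y' x'+y'≡ fuel =
    climb k x' y' Dx'y' (subst (n + n ≤_) (trans (sym (+-suc k (x + y))) (cong (k +_) (sym x'+y'≡))) fuel)

corner-maximal : ∀ {D a b x y} → DownClosed D → Corner D (a , b) → 1 ≤ a → 1 ≤ b →
                 D x y ≡ true → a ≤ x → b ≤ y → x ≡ a × y ≡ b
corner-maximal {D} {a} {b} {x} {y} D↓ (_ , Da+1b , Dab+1) 1≤a 1≤b Dxy a≤x b≤y with a ≟ x | b ≟ y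
... | yes refl | yes refl = refl , refl
... | no a≢x | _ with () ← trans (sym Da+1b) (D↓ x y (suc a) b Dxy (s≤s z≤n) (≤∧≢⇒< a≤x a≢x) 1≤b b≤y)
... | yes refl | no b≢y with () ← trans (sym Dab+1) (D↓ x y a (suc b) Dxy 1≤a a≤x (s≤s z≤n) (≤∧≢⇒< b≤y b≢y))

Minus-corner-isFerrers : ∀ {n D P} → IsFerrers n D → Corner D P → IsFerrers n (Minus D P)
Minus-corner-isFerrers {D = D} {P@(a , b)} (D0y , Dx0 , bounded , D↓) corner =
  (λ y → Minus-false D P (D0y y)) ,
  (λ x → Minus-false D P (Dx0 x)) ,
  (λ x y Mxy → bounded x y (Minus-⊆ D P Mxy)) ,
  M↓
  where
  M↓ : DownClosed (Minus D P)
  M↓ x y i j Mxy 1≤i i≤x 1≤j j≤y with i ≟ a ×-dec j ≟ b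
  ... | no ij≢ab = trans (Minus-keeps D ij≢ab) (D↓ x y i j (Minus-⊆ D P Mxy) 1≤i i≤x 1≤j j≤y)
  ... | yes (refl , refl) with corner-maximal D↓ corner 1≤i 1≤j (Minus-⊆ D P Mxy) i≤x j≤y
  ...   | refl , refl with () ← trans (sym (Minus-removes D a b)) Mxy

misses-T⇒¬irreducible : ∀ {n d D i j} → IsFerrers n D → Nonempty D →
                         1 ≤ i → 1 ≤ j → i + j ≤ d + 1 → D i j ≡ false → ¬ Irreducible n d D
misses-T⇒¬irreducible {n} {d} {D} F ne 1≤i 1≤j i+j≤ Dij irr
  with corner-exists F ne
... | P , corner@(DP , _) = irr (Minus D P , F' , inj₁ (P , (DP , λ _ _ → refl) , νmin-equal))
  where
  F' : IsFerrers n (Minus D P)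
  F' = Minus-corner-isFerrers F corner
  νmin-equal : νmin n d (Minus D P) ≡ νmin n d D
  νmin-equal = trans (νmin≡0-if-misses-T n d (Minus D P) (isFerrers⇒downClosed F') 1≤i 1≤j i+j≤
                        (Minus-false D P Dij))
                     (sym (νmin≡0-if-misses-T n d D (isFerrers⇒downClosed F) 1≤i 1≤j i+j≤ Dij))

ContainsT-arrowTail : ∀ {n d D D'} → 1 ≤ d → IsFerrers n D → ContainsT d D →
                      IsFerrers n D' → Arrow n d D' D → ContainsT d D'
ContainsT-arrowTail {D' = D'} _ _ T⊆D _ (inj₂ (P , (_ , D≡D'∖P) , _)) i j 1≤i 1≤j i+j≤ =
  Minus-⊆ D' P (trans (sym (D≡D'∖P i j)) (T⊆D i j 1≤i 1≤j i+j≤))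
ContainsT-arrowTail {n} {d} {D} {D'} 1≤d F T⊆D F' (inj₁ (_ , _ , νmin≡)) i j 1≤i 1≤j i+j≤
  with D' i j in D'ij
... | true  = refl
... | false with () ← subst (1 ≤_)
      (trans (sym νmin≡) (νmin≡0-if-misses-T n d D' (isFerrers⇒downClosed F') 1≤i 1≤j i+j≤ D'ij)) (1≤νmin n d D 1≤d F T⊆D)

proposition4p18 : (n d : ℕ) → 1 ≤ d → (D : Diagram) → IsFerrers n D → Nonempty D →
    Irreducible n d D ⇔ IsSourceGT n d D
proposition4p18 n d 1≤d D F ne = mk⇔ irreducible⇒source source⇒irreducible
  where
  irreducible⇒source : Irreducible n d D → IsSourceGT n d D
  irreducible⇒source irr = T⊆D , λ (D' , F' , _ , D'→D) → irr (D' , F' , D'→D)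
    where
    T⊆D : ContainsT d D
    T⊆D i j 1≤i 1≤j i+j≤ with D i j in Dij
    ... | true  = refl
    ... | false = ⊥-elim (misses-T⇒¬irreducible F ne 1≤i 1≤j i+j≤ Dij irr)

  source⇒irreducible : IsSourceGT n d D → Irreducible n d D
  source⇒irreducible (T⊆D , source) (D' , F' , D'→D) =
    source (D' , F' , ContainsT-arrowTail 1≤d F T⊆D F' D'→D , D'→D)
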